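{- Let $G\in\mathcal{G}(\widehat{C}_6,\widehat{C}_7)$ and $x\in V(G)$. Let $S^*=\{v\in N_2(x): |N(v)\cap N(x)|>1\}$, computed in $H_x$, and let $H^*_x$ be the induced subgraph of $H_x$ on $V(H_x)\setminus N[S^*]$ (closed neighborhood in $H_x$). Suppose $S^*$ is independent. Then $x$ is extendable in $H_x$ if and only if $x$ is extendable in $H^*_x$.
   Context: Graphs are finite, simple, undirected. $\mathcal{G}(\widehat{C}_6,\widehat{C}_7)$ is the class of graphs containing no (not necessarily induced) subgraph isomorphic to $C_6$ or $C_7$. For a nonempty vertex set $S$, $N(S)$ (resp. $N[S]$) is the set of vertices at distance exactly $1$ (resp. at most $1$) from $S$; $N_2(x)$ (resp. $N_2[x]$) the set at distance exactly $2$ (resp. at most $2$) from $x$; $N[\emptyset]=\emptyset$. A set $S$ dominates $T$ if $T\subseteq N[S]$. A vertex $v$ of a graph $H$ is extendable in $H$ if there is no independent set $S\subseteq N_2(v)$ which dominates $N(v)$, all neighborhoods taken in $H$. Construction of $H_x$ (neighborhoods in $G$): let $A^*$ be the set of all connected components $A_0$ of $G[N_2(x)]$ for which some $a_0\in V(A_0)$ satisfies $N(x)\cap N(a_0)=N(x)\cap N(V(A_0))$, let $V(A^*)$ be the union of their vertex sets, and $H_x=G[N_2[x]\setminus N[V(A^*)]]$. -}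

module Defs where

open import Data.Nat using (ℕ; suc)
open import Data.Fin using (Fin; zero; suc; inject₁; fromℕ)
open import Data.Fin.Subset using (Subset; _∈_)
open import Data.Product using (Σ; ∃; _×_; _,_)
open import Data.Sum using (_⊎_)
open import Data.Empty using (⊥)
open import Relation.Nullary using (¬_)
open import Relation.Binary using (Decidable)
open import Relation.Binary.PropositionalEquality using (_≡_; _≢_)
open import Function.Definitions using (Injective)

record Graph (n : ℕ) : Set₁ where
  field
    Adj     : Fin n → Fin n → Set
    adj?    : Decidable Adj
    sym     : ∀ {u v} → Adj u v → Adj v u
    irrefl  : ∀ {u} → ¬ Adj u u

module _ {n : ℕ} (G : Graph n) where
  open Graph G

  -- G contains a (not necessarily induced) cycle of length (suc m), for m ≥ 2:
  -- injective f with f i ~ f (i+1) and f m ~ f 0.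
  HasCycle : ℕ → Set
  HasCycle m = Σ (Fin (suc m) → Fin n) λ f →
    Injective _≡_ _≡_ f ×
    (∀ (i : Fin m) → Adj (f (inject₁ i)) (f (suc i))) ×
    Adj (f (fromℕ m)) (f zero)

  C67Free : Set
  C67Free = ¬ HasCycle 5 × ¬ HasCycle 6

  N1 : Fin n → Fin n → Set
  N1 x u = Adj x u

  N2 : Fin n → Fin n → Set
  N2 x u = u ≢ x × ¬ Adj x u × ∃ λ w → Adj x w × Adj w u

  N2c : Fin n → Fin n → Set
  N2c x u = u ≡ x ⊎ Adj x u ⊎ N2 x u

  NcSet : (Fin n → Set) → Fin n → Set
  NcSet S u = S u ⊎ ∃ λ s → S s × Adj s u

  NSet : (Fin n → Set) → Fin n → Set
  NSet S u = ¬ S u × ∃ λ s → S s × Adj s u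

  data Reach (P : Fin n → Set) (v : Fin n) : Fin n → Set where
    here : Reach P v v
    step : ∀ {u w} → Reach P v u → P w → Adj u w → Reach P v w

  -- vertex set of the connected component of G[N₂(x)] containing v (v ∈ N₂(x))
  Comp : Fin n → Fin n → Fin n → Set
  Comp x v w = Reach (N2 x) v w

  -- The component of v (in G[N₂(x)]) belongs to A*
  InAstarComp : Fin n → Fin n → Set
  InAstarComp x v = ∃ λ a₀ → Comp x v a₀ ×
    (∀ u → (N1 x u × Adj a₀ u) → (N1 x u × NSet (Comp x v) u)) ×
    (∀ u → (N1 x u × NSet (Comp x v) u) → (N1 x u × Adj a₀ u))

  VAstar : Fin n → Fin n → Set
  VAstar x v = N2 x v × InAstarComp x v

  -- vertex set of H_x = G[N₂[x] ∖ N[V(A*)]]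
  Hx : Fin n → Fin n → Set
  Hx x u = N2c x u × ¬ NcSet (VAstar x) u

  NIn : (Fin n → Set) → Fin n → Fin n → Set
  NIn W v u = W u × Adj v u

  N2In : (Fin n → Set) → Fin n → Fin n → Set
  N2In W v u = W u × u ≢ v × ¬ Adj v u × ∃ λ w → W w × Adj v w × Adj w u

  Extendable : (Fin n → Set) → Fin n → Set
  Extendable W v = ¬ Σ (Subset n) λ S →
    (∀ s → s ∈ S → N2In W v s) ×
    (∀ s t → s ∈ S → t ∈ S → ¬ Adj s t) ×
    (∀ u → NIn W v u → ∃ λ s → s ∈ S × (s ≡ u ⊎ Adj s u))

  Sstar : Fin n → Fin n → Set
  Sstar x v = N2In (Hx x) x v × ∃ λ u → ∃ λ w → u ≢ w ×
    (NIn (Hx x) v u × NIn (Hx x) x u) × (NIn (Hx x) v w × NIn (Hx x) x w)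

  HxStar : Fin n → Fin n → Set
  HxStar x u = Hx x u × ¬ (Sstar x u ⊎ ∃ λ s → Sstar x s × NIn (Hx x) s u)

module Submission where

-- Call S ⊆ N₂(x) a blocker of x in G[W] if it is independent and dominates N(x)
-- (all in G[W]); x is extendable exactly when there is no blocker.  The theorem
-- thus splits into two transfers of blockers, both carried out in the
-- double-negation monad (they form sets from undecidable predicates):
--   * extend-blocker: a blocker of x in H*_x together with S* is one in H_x;
--   * restrict-blocker: a blocker S in H_x, cut down to N₂(x) in H*_x, is one in H*_x.
-- The second rests on the key lemma blocker-misses-H*: no s ∈ S adjacent to some
-- s* ∈ S* has an x-neighbour in H*_x.  For two x-neighbours a, b of s*, the
-- C₆/C₇-free configurations of TwoNeighbours show that the dominator t ∈ S of a
-- has no other x-neighbour; since t ∉ V(A*), its component in G[N₂(x)] reaches a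
-- neighbour w of t adjacent to b.  Symmetrically for b, and a t w b t' w' is a C₆.

open import Defs
open import Data.Nat using (ℕ)
open import Data.Fin using (Fin)
open import Data.Product using (_×_)
open import Relation.Nullary using (¬_)

open import Data.Nat using (zero; suc)
open import Data.Fin using (zero; suc; inject₁; fromℕ; _≟_)
open import Data.Fin.Subset using (Subset; _∈_)
open import Data.Vec using (Vec; []; _∷_; lookup; tabulate)
open import Data.Vec.Properties using (lookup∘tabulate; []=⇒lookup; lookup⇒[]=)
open import Data.Vec.Relation.Unary.All using ([]; _∷_)
open import Data.Vec.Relation.Unary.AllPairs using ([]; _∷_)
open import Data.Vec.Relation.Unary.Linked using (Linked; [-]; _∷_)
open import Data.Vec.Relation.Unary.Unique.Propositional using (Unique)
open import Data.Vec.Relation.Unary.Unique.Propositional.Properties using (lookup-injective)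
open import Data.Product using (Σ; ∃; _,_; proj₁; proj₂)
open import Data.Sum using (_⊎_; inj₁; inj₂)
open import Data.Empty using (⊥; ⊥-elim)
open import Function.Bundles using (_⇔_; mk⇔; Equivalence)
open import Relation.Nullary using (Dec; yes; no; does)
open import Relation.Nullary.Decidable using (dec-true; ¬¬-excluded-middle)
open import Relation.Binary.PropositionalEquality using (_≡_; _≢_; refl; sym; trans; subst; ≢-sym)

open Equivalence using (to; from)

¬¬-decidable : ∀ {m} (P : Fin m → Set) → ¬ ¬ (∀ i → Dec (P i))
¬¬-decidable {zero} P k = k (λ ())
¬¬-decidable {suc m} P k =
  ¬¬-excluded-middle λ P0? → ¬¬-decidable (λ i → P (suc i)) λ P-suc? →
  k λ { zero → P0? ; (suc i) → P-suc? i }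

¬¬-subset : ∀ {m} (P : Fin m → Set) → ¬ ¬ (Σ (Subset m) λ S → ∀ i → i ∈ S ⇔ P i)
¬¬-subset {m} P k = ¬¬-decidable P λ P? →
  k (tabulate (λ i → does (P? i)) , λ i → mk⇔ (member⇒P P? i) (P⇒member P? i))
  where
  member⇒P : (P? : ∀ i → Dec (P i)) (i : Fin m) → i ∈ tabulate (λ j → does (P? j)) → P i
  member⇒P P? i i∈ with P? i | trans (sym (lookup∘tabulate _ i)) ([]=⇒lookup i∈)
  ... | yes p | _ = p
  ... | no _ | ()
  P⇒member : (P? : ∀ i → Dec (P i)) (i : Fin m) → P i → i ∈ tabulate (λ j → does (P? j))
  P⇒member P? i p = lookup⇒[]= i _ (trans (lookup∘tabulate _ i) (dec-true (P? i) p))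

linked-consecutive : ∀ {A : Set} {R : A → A → Set} {m} {vs : Vec A (suc m)} →
  Linked R vs → (i : Fin m) → R (lookup vs (inject₁ i)) (lookup vs (suc i))
linked-consecutive {vs = _ ∷ _ ∷ _} (r ∷ _) zero = r
linked-consecutive {vs = _ ∷ _ ∷ _} (_ ∷ rs) (suc i) = linked-consecutive rs i

module _ {n : ℕ} (G : Graph n) where
  open Graph G renaming (sym to adj-sym)

  adj⇒≢ : ∀ {u v} → Adj u v → u ≢ v
  adj⇒≢ uv refl = irrefl uv

  closed-walk-cycle : ∀ {m} (vs : Vec (Fin n) (suc m)) → Unique vs → Linked Adj vs →
    Adj (lookup vs (fromℕ m)) (lookup vs zero) → HasCycle G m
  closed-walk-cycle vs distinct walk closing =
    lookup vs , (λ {i} {j} → lookup-injective distinct i j) , linked-consecutive walk , closing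

  -- A closed walk v₀ … v₅ v₀ whose non-consecutive vertices are distinct is a
  -- 6-cycle (consecutive ones are distinct as G has no loops).
  six-cycle : ∀ {v₀ v₁ v₂ v₃ v₄ v₅} →
    Adj v₀ v₁ → Adj v₁ v₂ → Adj v₂ v₃ → Adj v₃ v₄ → Adj v₄ v₅ → Adj v₅ v₀ →
    v₀ ≢ v₂ → v₀ ≢ v₃ → v₀ ≢ v₄ → v₁ ≢ v₃ → v₁ ≢ v₄ → v₁ ≢ v₅ →
    v₂ ≢ v₄ → v₂ ≢ v₅ → v₃ ≢ v₅ → HasCycle G 5
  six-cycle {v₀} {v₁} {v₂} {v₃} {v₄} {v₅} e₀₁ e₁₂ e₂₃ e₃₄ e₄₅ e₅₀
    d₀₂ d₀₃ d₀₄ d₁₃ d₁₄ d₁₅ d₂₄ d₂₅ d₃₅ =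
    closed-walk-cycle (v₀ ∷ v₁ ∷ v₂ ∷ v₃ ∷ v₄ ∷ v₅ ∷ [])
      ( (adj⇒≢ e₀₁ ∷ d₀₂ ∷ d₀₃ ∷ d₀₄ ∷ ≢-sym (adj⇒≢ e₅₀) ∷ [])
      ∷ (adj⇒≢ e₁₂ ∷ d₁₃ ∷ d₁₄ ∷ d₁₅ ∷ [])
      ∷ (adj⇒≢ e₂₃ ∷ d₂₄ ∷ d₂₅ ∷ [])
      ∷ (adj⇒≢ e₃₄ ∷ d₃₅ ∷ [])
      ∷ (adj⇒≢ e₄₅ ∷ [])
      ∷ [] ∷ [])
      (e₀₁ ∷ e₁₂ ∷ e₂₃ ∷ e₃₄ ∷ e₄₅ ∷ [-])
      e₅₀

  seven-cycle : ∀ {v₀ v₁ v₂ v₃ v₄ v₅ v₆} →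
    Adj v₀ v₁ → Adj v₁ v₂ → Adj v₂ v₃ → Adj v₃ v₄ → Adj v₄ v₅ → Adj v₅ v₆ → Adj v₆ v₀ →
    v₀ ≢ v₂ → v₀ ≢ v₃ → v₀ ≢ v₄ → v₀ ≢ v₅ → v₁ ≢ v₃ → v₁ ≢ v₄ → v₁ ≢ v₅ → v₁ ≢ v₆ →
    v₂ ≢ v₄ → v₂ ≢ v₅ → v₂ ≢ v₆ → v₃ ≢ v₅ → v₃ ≢ v₆ → v₄ ≢ v₆ → HasCycle G 6
  seven-cycle {v₀} {v₁} {v₂} {v₃} {v₄} {v₅} {v₆} e₀₁ e₁₂ e₂₃ e₃₄ e₄₅ e₅₆ e₆₀
    d₀₂ d₀₃ d₀₄ d₀₅ d₁₃ d₁₄ d₁₅ d₁₆ d₂₄ d₂₅ d₂₆ d₃₅ d₃₆ d₄₆ =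
    closed-walk-cycle (v₀ ∷ v₁ ∷ v₂ ∷ v₃ ∷ v₄ ∷ v₅ ∷ v₆ ∷ [])
      ( (adj⇒≢ e₀₁ ∷ d₀₂ ∷ d₀₃ ∷ d₀₄ ∷ d₀₅ ∷ ≢-sym (adj⇒≢ e₆₀) ∷ [])
      ∷ (adj⇒≢ e₁₂ ∷ d₁₃ ∷ d₁₄ ∷ d₁₅ ∷ d₁₆ ∷ [])
      ∷ (adj⇒≢ e₂₃ ∷ d₂₄ ∷ d₂₅ ∷ d₂₆ ∷ [])
      ∷ (adj⇒≢ e₃₄ ∷ d₃₅ ∷ d₃₆ ∷ [])
      ∷ (adj⇒≢ e₄₅ ∷ d₄₆ ∷ [])
      ∷ (adj⇒≢ e₅₆ ∷ [])
      ∷ [] ∷ [])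
      (e₀₁ ∷ e₁₂ ∷ e₂₃ ∷ e₃₄ ∷ e₄₅ ∷ e₅₆ ∷ [-])
      e₆₀

  x≢N2 : ∀ {x v} → N2 G x v → x ≢ v
  x≢N2 (v≢x , _) = ≢-sym v≢x

  N1≢N2 : ∀ {x p q} → Adj x p → N2 G x q → p ≢ q
  N1≢N2 xp (_ , x≁q , _) refl = x≁q xp

  N2In⇒N2 : ∀ {W x v} → N2In G W x v → N2 G x v
  N2In⇒N2 (_ , v≢x , x≁v , w , _ , xw , wv) = v≢x , x≁v , w , xw , wv

  N2In-mono : ∀ {W W' : Fin n → Set} {x v} → (∀ {u} → W u → W' u) →
    N2In G W x v → N2In G W' x v
  N2In-mono W⊆W' (Wv , v≢x , x≁v , w , Ww , xw , wv) =
    W⊆W' Wv , v≢x , x≁v , w , W⊆W' Ww , xw , wv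

  reach-closed : ∀ {P : Fin n → Set} {v w} → P v → Reach G P v w → P w
  reach-closed Pv here = Pv
  reach-closed _ (step _ Pw _) = Pw

  -- The component of t in G[N₂(x)] belongs to A* as soon as every x-neighbour of
  -- the component is already a neighbour of t (witnessed by a₀ = t).
  component-in-A* : ∀ {x t} → N2 G x t →
    (∀ {y c} → Comp G x t y → Adj x c → Adj y c → Adj t c) → VAstar G x t
  component-in-A* {x} {t} n2t covered = n2t , t , here , into-boundary , out-of-boundary
    where
    into-boundary : ∀ c → N1 G x c × Adj t c → N1 G x c × NSet G (Comp G x t) c
    into-boundary c (xc , tc) = xc , (λ r → proj₁ (proj₂ (reach-closed n2t r)) xc) , t , here , tc
    out-of-boundary : ∀ c → N1 G x c × NSet G (Comp G x t) c → N1 G x c × Adj t c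
    out-of-boundary c (xc , _ , y , r , yc) = xc , covered r xc yc

  IsBlocker : (Fin n → Set) → Fin n → Subset n → Set
  IsBlocker W x S =
    (∀ s → s ∈ S → N2In G W x s) ×
    (∀ s t → s ∈ S → t ∈ S → ¬ Adj s t) ×
    (∀ u → NIn G W x u → ∃ λ s → s ∈ S × (s ≡ u ⊎ Adj s u))

  -- A blocker dominates each x-neighbour through an adjacent vertex, since it
  -- lies at distance two from x.
  dominator : ∀ {W x S u} → IsBlocker W x S → NIn G W x u → ∃ λ s → s ∈ S × Adj s u
  dominator {u = u} (inN2 , _ , dominates) xu with dominates u xu
  ... | s , s∈S , inj₂ su = s , s∈S , su
  ... | s , s∈S , inj₁ refl = ⊥-elim (proj₁ (proj₂ (proj₂ (inN2 s s∈S))) (proj₂ xu))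

  NearS* : Fin n → Fin n → Set
  NearS* x v = Sstar G x v ⊎ ∃ λ s* → Sstar G x s* × NIn G (Hx G x) s* v

  module TwoNeighbours (free : C67Free G) {x a b s* : Fin n}
    (xa : Adj x a) (xb : Adj x b) (a≢b : a ≢ b)
    (n2s* : N2 G x s*) (s*a : Adj s* a) (s*b : Adj s* b) where

    -- No path a y₁ y₂ y₃ b inside N₂(x) with y₁ ≠ y₃: C₆ = x a y₁ y₂ y₃ b.
    no-ab-path : ∀ {y₁ y₂ y₃} → N2 G x y₁ → N2 G x y₂ → N2 G x y₃ →
      Adj a y₁ → Adj y₁ y₂ → Adj y₂ y₃ → Adj y₃ b → y₁ ≢ y₃ → ⊥
    no-ab-path n2y₁ n2y₂ n2y₃ ay₁ y₁y₂ y₂y₃ y₃b y₁≢y₃ =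
      proj₁ free (six-cycle xa ay₁ y₁y₂ y₂y₃ y₃b (adj-sym xb)
        (x≢N2 n2y₁) (x≢N2 n2y₂) (x≢N2 n2y₃) (N1≢N2 xa n2y₂) (N1≢N2 xa n2y₃) a≢b
        y₁≢y₃ (≢-sym (N1≢N2 xb n2y₁)) (≢-sym (N1≢N2 xb n2y₂)))

    -- A vertex v ≠ s* of N₂(x) adjacent to a has no x-neighbour c ∉ {a, b}:
    -- C₆ = x c v a s* b.
    no-third-neighbour : ∀ {v c} → N2 G x v → Adj v a → Adj x c → Adj v c →
      c ≢ a → c ≢ b → v ≢ s* → ⊥
    no-third-neighbour n2v va xc vc c≢a c≢b v≢s* =
      proj₁ free (six-cycle xc (adj-sym vc) va (adj-sym s*a) s*b (adj-sym xb)
        (x≢N2 n2v) (adj⇒≢ xa) (x≢N2 n2s*) c≢a (N1≢N2 xc n2s*) c≢b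
        v≢s* (≢-sym (N1≢N2 xb n2v)) a≢b)

    -- Nor does a neighbour y' ≠ s* in N₂(x) of such a vertex y: C₇ = x c y' y a s* b.
    no-third-neighbour₂ : ∀ {y y' c} → N2 G x y → N2 G x y' → Adj y a → Adj y y' →
      Adj x c → Adj y' c → c ≢ a → c ≢ b → y ≢ s* → y' ≢ s* → ⊥
    no-third-neighbour₂ n2y n2y' ya yy' xc y'c c≢a c≢b y≢s* y'≢s* =
      proj₂ free (seven-cycle xc (adj-sym y'c) (adj-sym yy') ya (adj-sym s*a) s*b (adj-sym xb)
        (x≢N2 n2y') (x≢N2 n2y) (adj⇒≢ xa) (x≢N2 n2s*)
        (N1≢N2 xc n2y) c≢a (N1≢N2 xc n2s*) c≢b
        (≢-sym (N1≢N2 xa n2y')) y'≢s* (≢-sym (N1≢N2 xb n2y'))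
        y≢s* (≢-sym (N1≢N2 xb n2y)) a≢b)

    Lonely : Fin n → Set
    Lonely y = ∀ {c} → Adj x c → Adj y c → c ≡ a

    lonely-adj : ∀ {y} → N2 G x y → Lonely y → Adj y a
    lonely-adj (_ , _ , w , xw , wy) lonely = subst (Adj _) (lonely xw (adj-sym wy)) (adj-sym wy)

    lonely-≢ : ∀ {y v c} → Lonely y → Adj x c → Adj v c → c ≢ a → y ≢ v
    lonely-≢ lonely xc vc c≢a refl = c≢a (lonely xc vc)

    module Detour {u s : Fin n} (xu : Adj x u) (u≢a : u ≢ a) (u≢b : u ≢ b)
      (n2s : N2 G x s) (ss* : Adj s s*) (su : Adj s u) where

      -- C₆ = x u s a s* b.
      s≁a : ¬ Adj s a
      s≁a sa = proj₁ free (six-cycle xu (adj-sym su) sa (adj-sym s*a) s*b (adj-sym xb)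
        (x≢N2 n2s) (adj⇒≢ xa) (x≢N2 n2s*) u≢a (N1≢N2 xu n2s*) u≢b
        (adj⇒≢ ss*) (≢-sym (N1≢N2 xb n2s)) a≢b)

      -- a and b have no common neighbour in N₂(x) besides s and s*: C₇ = x u s s* a v b.
      no-common-neighbour : ∀ {v} → N2 G x v → Adj v a → Adj v b → v ≢ s → v ≢ s* → ⊥
      no-common-neighbour n2v va vb v≢s v≢s* =
        proj₂ free (seven-cycle xu (adj-sym su) ss* s*a (adj-sym va) vb (adj-sym xb)
          (x≢N2 n2s) (x≢N2 n2s*) (adj⇒≢ xa) (x≢N2 n2v)
          (N1≢N2 xu n2s*) u≢a (N1≢N2 xu n2v) u≢b
          (≢-sym (N1≢N2 xa n2s)) (≢-sym v≢s) (≢-sym (N1≢N2 xb n2s))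
          (≢-sym v≢s*) (≢-sym (N1≢N2 xb n2s*)) a≢b)

      -- a and s* have no common neighbour in N₂(x) besides s: C₆ = x u s s* v a.
      no-second-link : ∀ {v} → N2 G x v → Adj v a → Adj v s* → v ≢ s → ⊥
      no-second-link n2v va vs* v≢s =
        proj₁ free (six-cycle xu (adj-sym su) ss* (adj-sym vs*) va (adj-sym xa)
          (x≢N2 n2s) (x≢N2 n2s*) (x≢N2 n2v) (N1≢N2 xu n2s*) (N1≢N2 xu n2v) u≢a
          (≢-sym v≢s) (≢-sym (N1≢N2 xa n2s)) (≢-sym (N1≢N2 xa n2s*)))

      -- Lonely vertices are neither s (which sees u) nor s* (which sees b).
      lonely-≢s : ∀ {y} → Lonely y → y ≢ s
      lonely-≢s lonely = lonely-≢ lonely xu su u≢a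

      lonely-≢s* : ∀ {y} → Lonely y → y ≢ s*
      lonely-≢s* lonely = lonely-≢ lonely xb s*b (≢-sym a≢b)

      lonely-step : ∀ {y y'} → N2 G x y → Lonely y → N2 G x y' → Adj y y' → ¬ Adj y' b →
        Lonely y'
      lonely-step {y' = y'} n2y lonely n2y' yy' y'≁b {c} xc y'c with c ≟ a
      ... | yes c≡a = c≡a
      ... | no c≢a with y' ≟ s* | c ≟ b
      ...   | yes refl | _ =
        ⊥-elim (no-second-link n2y (lonely-adj n2y lonely) yy' (lonely-≢s lonely))
      ...   | no _ | yes refl = ⊥-elim (y'≁b y'c)
      ...   | no y'≢s* | no c≢b =
        ⊥-elim (no-third-neighbour₂ n2y n2y' (lonely-adj n2y lonely) yy' xc y'c c≢a c≢b
          (lonely-≢s* lonely) y'≢s*)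

      module Dominator {S : Subset n} (blocker : IsBlocker (Hx G x) x S) (s∈S : s ∈ S)
        (aH : Hx G x a) where

        independent : ∀ v w → v ∈ S → w ∈ S → ¬ Adj v w
        independent = proj₁ (proj₂ blocker)

        t : Fin n
        t = proj₁ (dominator blocker (aH , xa))

        t∈S : t ∈ S
        t∈S = proj₁ (proj₂ (dominator blocker (aH , xa)))

        ta : Adj t a
        ta = proj₂ (proj₂ (dominator blocker (aH , xa)))

        n2t : N2 G x t
        n2t = N2In⇒N2 (proj₁ blocker t t∈S)

        t≢s : t ≢ s
        t≢s t≡s = s≁a (subst (λ z → Adj z a) t≡s ta)

        t≢s* : t ≢ s*
        t≢s* t≡s* = independent s t s∈S t∈S (subst (Adj s) (sym t≡s*) ss*)

        t≁b : ¬ Adj t b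
        t≁b tb = no-common-neighbour n2t ta tb t≢s t≢s*

        t-lonely : Lonely t
        t-lonely {c} xc tc with c ≟ a | c ≟ b
        ... | yes c≡a | _ = c≡a
        ... | no _ | yes refl = ⊥-elim (t≁b tc)
        ... | no c≢a | no c≢b = ⊥-elim (no-third-neighbour n2t ta xc tc c≢a c≢b t≢s*)

        Bridge : Set
        Bridge = ∃ λ w → Adj t w × N2 G x w × Adj w b

        -- Without a bridge the whole component of t in G[N₂(x)] is lonely: a
        -- first vertex seeing b would close a path a y₁ y₂ y₃ b.
        component-lonely : ¬ Bridge → ∀ {y} → Comp G x t y → Lonely y
        component-misses-b : ¬ Bridge → ∀ {y y'} → Comp G x t y → N2 G x y' → Adj y y' →
          ¬ Adj y' b

        component-lonely no-bridge here = t-lonely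
        component-lonely no-bridge (step r n2y' yy') =
          lonely-step (reach-closed n2t r) (component-lonely no-bridge r) n2y' yy'
            (component-misses-b no-bridge r n2y' yy')

        component-misses-b no-bridge here n2y' ty' y'b = no-bridge (_ , ty' , n2y' , y'b)
        component-misses-b no-bridge (step {y₁} r n2y y₁y) n2y' yy' y'b =
          no-ab-path n2y₁ n2y n2y' (adj-sym (lonely-adj n2y₁ y₁-lonely)) y₁y yy' y'b
            (lonely-≢ y₁-lonely xb y'b (≢-sym a≢b))
          where
          n2y₁ : N2 G x y₁
          n2y₁ = reach-closed n2t r
          y₁-lonely : Lonely y₁
          y₁-lonely = component-lonely no-bridge r

        -- t ∈ V(H_x) lies outside V(A*), so its component cannot be lonely.
        bridge : ¬ ¬ Bridge
        bridge no-bridge = t∉N[A*] (inj₁ (component-in-A* n2t covered))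
          where
          t∉N[A*] : ¬ NcSet G (VAstar G x) t
          t∉N[A*] = proj₂ (proj₁ (proj₁ blocker t t∈S))
          covered : ∀ {y c} → Comp G x t y → Adj x c → Adj y c → Adj t c
          covered r xc yc = subst (Adj t) (sym (component-lonely no-bridge r xc yc)) ta

        -- A bridge does not see a, being a common neighbour of a and b other than
        -- s (t and s are independent) and s* (t does not see s*).
        bridge-misses-a : ∀ {w} → Adj t w → N2 G x w → Adj w b → ¬ Adj w a
        bridge-misses-a tw n2w wb wa = no-common-neighbour n2w wa wb w≢s w≢s*
          where
          w≢s : _ ≢ s
          w≢s w≡s = independent t s t∈S s∈S (subst (Adj t) w≡s tw)
          w≢s* : _ ≢ s*
          w≢s* w≡s* = no-second-link n2t ta (subst (Adj t) w≡s* tw) t≢s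

  -- Otherwise, with a, b the two x-neighbours of
  -- s*, the dominators t of a and t' of b have bridges w, w', and a t w b t' w'
  -- is a 6-cycle.
  blocker-misses-H* : C67Free G → ∀ {x S s s* u} → IsBlocker (Hx G x) x S → s ∈ S →
    Sstar G x s* → Adj s* s → HxStar G x u → Adj x u → Adj s u → ⊥
  blocker-misses-H* free {x} {s = s} {s*} {u} blocker s∈S
    S*s*@(n2s* , a , b , a≢b , ((aH , s*a) , (_ , xa)) , ((bH , s*b) , (_ , xb)))
    s*s (_ , u∉N[S*]) xu su = A.bridge λ bridge-a → B.bridge λ bridge-b → hexagon bridge-a bridge-b
    where
    u≢ : ∀ {c} → NIn G (Hx G x) s* c → u ≢ c
    u≢ s*c u≡c = u∉N[S*] (inj₂ (s* , S*s* , subst (NIn G (Hx G x) s*) (sym u≡c) s*c))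

    n2s : N2 G x s
    n2s = N2In⇒N2 (proj₁ blocker s s∈S)
    module TA = TwoNeighbours free xa xb a≢b (N2In⇒N2 n2s*) s*a s*b
    module TB = TwoNeighbours free xb xa (≢-sym a≢b) (N2In⇒N2 n2s*) s*b s*a
    module A = TA.Detour.Dominator xu (u≢ (aH , s*a)) (u≢ (bH , s*b)) n2s (adj-sym s*s) su
      blocker s∈S aH
    module B = TB.Detour.Dominator xu (u≢ (bH , s*b)) (u≢ (aH , s*a)) n2s (adj-sym s*s) su
      blocker s∈S bH

    hexagon : A.Bridge → B.Bridge → ⊥
    hexagon (w , tw , n2w , wb) (w' , t'w' , n2w' , w'a) =
      proj₁ free (six-cycle (adj-sym A.ta) tw wb (adj-sym B.ta) t'w' w'a
        (N1≢N2 xa n2w) a≢b (N1≢N2 xa B.n2t)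
        (≢-sym (N1≢N2 xb A.n2t)) t≢t' t≢w'
        w≢t' w≢w' (N1≢N2 xb n2w'))
      where
      t≢t' : A.t ≢ B.t
      t≢t' t≡t' = A.t≁b (subst (λ z → Adj z b) (sym t≡t') B.ta)
      t≢w' : A.t ≢ w'
      t≢w' t≡w' = A.independent B.t A.t B.t∈S A.t∈S (subst (Adj B.t) (sym t≡w') t'w')
      w≢t' : w ≢ B.t
      w≢t' w≡t' = A.independent A.t B.t A.t∈S B.t∈S (subst (Adj A.t) w≡t' tw)
      w≢w' : w ≢ w'
      w≢w' w≡w' = A.bridge-misses-a tw n2w wb (subst (λ z → Adj z a) (sym w≡w') w'a)

  -- A blocker S of x in H_x, restricted to N₂(x) taken in H*_x, is a blocker in
  -- H*_x: by the key lemma the dominator in S of an x-neighbour in H*_x lies in H*_x.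
  restrict-blocker : C67Free G → ∀ {x S} → IsBlocker (Hx G x) x S →
    ¬ ¬ Σ (Subset n) (IsBlocker (HxStar G x) x)
  restrict-blocker free {x} {S} blocker@(_ , independent , _) k =
    ¬¬-subset InRestriction λ (T , T⇔) →
      k (T , (λ v v∈T → proj₂ (to (T⇔ v) v∈T))
           , (λ v w v∈T w∈T → independent v w (proj₁ (to (T⇔ v) v∈T)) (proj₁ (to (T⇔ w) w∈T)))
           , λ v xv → dominated T T⇔ xv)
    where
    InRestriction : Fin n → Set
    InRestriction v = v ∈ S × N2In G (HxStar G x) x v

    dominated : (T : Subset n) → (∀ i → i ∈ T ⇔ InRestriction i) →
      ∀ {v} → NIn G (HxStar G x) x v → ∃ λ s → s ∈ T × (s ≡ v ⊎ Adj s v)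
    dominated T T⇔ (vH*@(vH , v∉N[S*]) , xv) with dominator blocker (vH , xv)
    ... | s , s∈S , sv = s , from (T⇔ s) (s∈S , sH* , s≢x , x≁s , _ , vH* , xv , adj-sym sv) , inj₂ sv
      where
      n2s : N2In G (Hx G x) x s
      n2s = proj₁ blocker s s∈S
      s≢x : s ≢ x
      s≢x = proj₁ (proj₂ n2s)
      x≁s : ¬ Adj x s
      x≁s = proj₁ (proj₂ (proj₂ n2s))
      s∉N[S*] : ¬ NearS* x s
      s∉N[S*] (inj₁ S*s) = v∉N[S*] (inj₂ (s , S*s , vH , sv))
      s∉N[S*] (inj₂ (s* , S*s* , _ , s*s)) = blocker-misses-H* free blocker s∈S S*s* s*s vH* xv sv
      sH* : HxStar G x s
      sH* = proj₁ n2s , s∉N[S*]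

  -- A blocker S' of x in H*_x together with S* is a blocker in H_x when S* is
  -- independent: S' avoids N_{H_x}[S*], and x-neighbours in N_{H_x}[S*] are
  -- dominated by S* (they are not in S* ⊆ N₂(x)).
  extend-blocker : ∀ {x S'} → (∀ a b → Sstar G x a → Sstar G x b → ¬ Adj a b) →
    IsBlocker (HxStar G x) x S' → ¬ ¬ Σ (Subset n) (IsBlocker (Hx G x) x)
  extend-blocker {x} {S'} S*-independent (inN2' , independent' , dominates') k =
    ¬¬-decidable (NearS* x) λ near? → ¬¬-subset InUnion λ (T , T⇔) →
      k (T , (λ v v∈T → inN2 (to (T⇔ v) v∈T))
           , (λ v w v∈T w∈T → independent (to (T⇔ v) v∈T) (to (T⇔ w) w∈T))
           , λ v xv → dominated T T⇔ near? xv)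
    where
    InUnion : Fin n → Set
    InUnion v = v ∈ S' ⊎ Sstar G x v

    inN2 : ∀ {v} → InUnion v → N2In G (Hx G x) x v
    inN2 {v} (inj₁ v∈S') = N2In-mono proj₁ (inN2' v v∈S')
    inN2 (inj₂ S*v) = proj₁ S*v

    apart : ∀ {v w} → v ∈ S' → Sstar G x w → ¬ Adj v w
    apart {v} {w} v∈S' S*w vw with proj₁ (inN2' v v∈S')
    ... | vH , v∉N[S*] = v∉N[S*] (inj₂ (w , S*w , vH , adj-sym vw))

    independent : ∀ {v w} → InUnion v → InUnion w → ¬ Adj v w
    independent {v} {w} (inj₁ v∈S') (inj₁ w∈S') = independent' v w v∈S' w∈S'
    independent (inj₁ v∈S') (inj₂ S*w) = apart v∈S' S*w
    independent (inj₂ S*v) (inj₁ w∈S') vw = apart w∈S' S*v (adj-sym vw)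
    independent {v} {w} (inj₂ S*v) (inj₂ S*w) = S*-independent v w S*v S*w

    dominated : (T : Subset n) → (∀ i → i ∈ T ⇔ InUnion i) → (∀ v → Dec (NearS* x v)) →
      ∀ {v} → NIn G (Hx G x) x v → ∃ λ s → s ∈ T × (s ≡ v ⊎ Adj s v)
    dominated T T⇔ near? {v} (vH , xv) with near? v
    ... | yes (inj₁ S*v) = ⊥-elim (proj₁ (proj₂ (proj₂ (proj₁ S*v))) xv)
    ... | yes (inj₂ (s* , S*s* , _ , s*v)) = s* , from (T⇔ s*) (inj₂ S*s*) , inj₂ s*v
    ... | no v∉N[S*] with dominates' v ((vH , v∉N[S*]) , xv)
    ...   | s , s∈S' , s-dom = s , from (T⇔ s) (inj₁ s∈S') , s-dom

lemma10 : ∀ {n : ℕ} (G : Graph n) → C67Free G → (x : Fin n) →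
    (∀ a b → Sstar G x a → Sstar G x b → ¬ Graph.Adj G a b) →
    (Extendable G (Hx G x) x → Extendable G (HxStar G x) x) ×
    (Extendable G (HxStar G x) x → Extendable G (Hx G x) x)
lemma10 G free x S*-independent =
  (λ extendable (S' , blocks) → extend-blocker G S*-independent blocks extendable) ,
  (λ extendable* (S , blocks) → restrict-blocker G free blocks extendable*)
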